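{- Let $s$ be an odd positive integer and $t$ a positive integer. Suppose $c$ is a coloring of $\mathbb{Z}_{st}$ that does not have a rainbow $3$-AP. For $i=0,\dots,s-1$ let $R_i=\{j\in\mathbb{Z}_{st}: j\equiv i \pmod s\}$ and $P_i=\{c(\ell):\ell\in R_i\}$. Let $m$ be an index such that $|P_m|\ge|P_i|$ for all $i$. Then $|P_i\setminus P_m|\le 1$ for all $i$.
   Context: $\mathbb{Z}_n$ is the cyclic group of integers mod $n$. A $3$-AP in $\mathbb{Z}_n$ is a set of three distinct elements $a,a+d,a+2d$ (mod $n$), $d\not\equiv0$; it is rainbow under a coloring $c$ if its three elements receive distinct colors. -}

module Defs where

open import Data.Nat using (ℕ; _+_; _*_; _%_; _≤_; NonZero)
open import Data.Nat.Properties using (_≟_)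
open import Data.Nat.DivMod using (_mod_)
open import Data.Fin using (Fin; toℕ)
open import Data.List using (List; map; filter; deduplicate; allFin; length)
open import Data.List.Membership.DecPropositional _≟_ using (_∉?_)
open import Data.Product using (∃; _×_)
open import Relation.Binary.PropositionalEquality using (_≡_; _≢_)

-- A coloring of ℤ_n: elements of ℤ_n are Fin n (residues 0..n-1), colors are naturals.
Coloring : ℕ → Set
Coloring n = Fin n → ℕ

ap₁ : (n : ℕ) .{{_ : NonZero n}} → Fin n → Fin n → Fin n
ap₁ n a d = (toℕ a + toℕ d) mod n

ap₂ : (n : ℕ) .{{_ : NonZero n}} → Fin n → Fin n → Fin n
ap₂ n a d = (toℕ a + 2 * toℕ d) mod n

RainbowAP : (n : ℕ) .{{_ : NonZero n}} → Coloring n → Fin n → Fin n → Set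
RainbowAP n c a d =
  (toℕ d ≢ 0)
  × (a ≢ ap₁ n a d) × (a ≢ ap₂ n a d) × (ap₁ n a d ≢ ap₂ n a d)
  × (c a ≢ c (ap₁ n a d)) × (c a ≢ c (ap₂ n a d)) × (c (ap₁ n a d) ≢ c (ap₂ n a d))

HasRainbow3AP : (n : ℕ) .{{_ : NonZero n}} → Coloring n → Set
HasRainbow3AP n c = ∃ λ a → ∃ λ d → RainbowAP n c a d

R : (s t : ℕ) .{{_ : NonZero s}} → Fin s → List (Fin (s * t))
R s t i = filter (λ j → toℕ j % s ≟ toℕ i) (allFin (s * t))

P : (s t : ℕ) .{{_ : NonZero s}} → Coloring (s * t) → Fin s → List ℕ
P s t c i = deduplicate _≟_ (map c (R s t i))

_∖_ : List ℕ → List ℕ → List ℕ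
A ∖ B = filter (λ x → x ∉? B) A

module Submission where

-- Say the class C is the mirror image of the class B in A when C + B ≡ 2A
-- (mod s).  If A has two colours a ≠ b that B lacks, then C and B carry the same
-- colours (reflection lemma): reflecting z ∈ C through a point of colour b shows z cannot have colour a,
-- and then reflecting z through a point x of colour a yields v ∈ B with z, x, v a
-- 3-AP, so c z = c v.  If two classes I, M each had two colours the other lacks,
-- iterating the reflection lemma along the progression I, M, 2M − I, … (mod s) would
-- show that the classes alternate between the colour sets of I and of M; since s is
-- odd the progression returns to I after s steps at an odd position, so I and M
-- would carry the same colours, a contradiction.  Finally a counting argument on
-- duplicate-free lists shows |P_i ∖ P_m| ≤ |P_m ∖ P_i| when |P_i| ≤ |P_m|, so
-- |P_i ∖ P_m| ≥ 2 would force the forbidden mutual situation.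

open import Defs
open import Data.Nat using (ℕ; zero; suc; _+_; _*_; _∸_; _%_; _/_; _≤_; _<_; NonZero; z≤n; s≤s)
open import Data.Nat.Properties
  using (_≟_; _≤?_; +-comm; +-assoc; +-suc; ≤-reflexive; +-identityʳ; *-comm; m+[n∸m]≡n; m∸n+n≡m; <⇒≤; ≰⇒>;
         ≤-trans; +-monoʳ-≤; +-cancelʳ-≤; m*n≢0; module ≤-Reasoning)
open import Data.Nat.DivMod
  using (_mod_; %-distribˡ-+; %-distribˡ-*; m%n%n≡m%n; [m+n]%n≡m%n; [m+kn]%n≡m%n;
         m<n⇒m%n≡m; m%n≤n; m%n<n; m≡m%n+[m/n]*n; m∣n⇒o%n%m≡o%m)
open import Data.Nat.Divisibility using (_∣_; m∣m*n)
open import Data.Nat.Solver using (module +-*-Solver)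
open import Data.Fin using (Fin; toℕ)
open import Data.Fin.Properties using (toℕ-fromℕ<; toℕ-injective; toℕ<n)
open import Data.List using (List; []; _∷_; _++_; filter; length; allFin)
open import Data.List.Properties using (length-++-sucʳ)
open import Data.List.Membership.DecPropositional _≟_ using (_∈_; _∈?_)
open import Data.List.Membership.Propositional.Properties
  using (∈-filter⁻; ∈-filter⁺; ∈-deduplicate⁺; ∈-deduplicate⁻; ∈-map∘filter⁻;
         ∈-map∘filter⁺; ∈-allFin; ∈-∃++; ∈-++⁻; ∈-++⁺ˡ; ∈-++⁺ʳ)
open import Data.List.Relation.Unary.All using (lookup; _∷_)
open import Data.List.Relation.Unary.Any using (here; there)
open import Data.List.Relation.Unary.Unique.Propositional using (Unique; []; _∷_)
open import Data.List.Relation.Unary.Unique.Propositional.Properties using (filter⁺)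
open import Data.List.Relation.Unary.Unique.DecPropositional.Properties _≟_ using (deduplicate-!)
open import Level using (0ℓ)
open import Data.Product using (Σ; ∃; _×_; _,_; proj₂)
open import Data.Sum using (_⊎_; inj₁; inj₂)
open import Data.Empty using (⊥; ⊥-elim)
open import Function.Bundles using (_⇔_; mk⇔; Equivalence)
open import Function.Properties.Equivalence using (⇔-isEquivalence)
open import Relation.Unary using (Decidable)
open import Relation.Binary.Structures using (IsEquivalence)
open import Relation.Nullary using (¬_; yes; no)
open import Relation.Unary.Properties using (∁?)
open import Relation.Binary.PropositionalEquality
  using (_≡_; _≢_; refl; sym; trans; cong; cong₂; subst; module ≡-Reasoning)

open +-*-Solver using (solve; _:=_; _:+_; _:*_; con)

module Congruence (n : ℕ) .{{_ : NonZero n}} where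

  open ≡-Reasoning

  infix 4 _≈_
  _≈_ : ℕ → ℕ → Set
  a ≈ b = a % n ≡ b % n

  mod-≈ : ∀ a → a % n ≈ a
  mod-≈ a = m%n%n≡m%n a n

  +-cong : ∀ {a a′ b b′} → a ≈ a′ → b ≈ b′ → a + b ≈ a′ + b′
  +-cong {a} {a′} {b} {b′} a≈a′ b≈b′ = begin
    (a + b) % n             ≡⟨ %-distribˡ-+ a b n ⟩
    (a % n + b % n) % n     ≡⟨ cong₂ (λ u v → (u + v) % n) a≈a′ b≈b′ ⟩
    (a′ % n + b′ % n) % n   ≡⟨ %-distribˡ-+ a′ b′ n ⟨
    (a′ + b′) % n           ∎

  *-congˡ : ∀ k {a b} → a ≈ b → k * a ≈ k * b
  *-congˡ k {a} {b} a≈b = begin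
    (k * a) % n             ≡⟨ %-distribˡ-* k a n ⟩
    (k % n * (a % n)) % n   ≡⟨ cong (λ u → (k % n * u) % n) a≈b ⟩
    (k % n * (b % n)) % n   ≡⟨ %-distribˡ-* k b n ⟨
    (k * b) % n             ∎

  -- Adding the complement n ∸ (k % n) undoes adding k, hence addition cancels.
  +-cancelˡ : ∀ k {a b} → k + a ≈ k + b → a ≈ b
  +-cancelˡ k {a} {b} k+a≈k+b = trans (sym (undo a)) (trans (+-cong k+a≈k+b refl) (undo b))
    where
    k′ : ℕ
    k′ = n ∸ k % n
    undo : ∀ x → (k + x) + k′ ≈ x
    undo x = begin
      (k + x + k′) % n          ≡⟨ +-cong (+-cong (sym (mod-≈ k)) refl) refl ⟩
      (k % n + x + k′) % n      ≡⟨ cong (_% n) (solve 3 (λ r x k′ → r :+ x :+ k′ := x :+ (r :+ k′)) refl (k % n) x k′) ⟩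
      (x + (k % n + k′)) % n    ≡⟨ cong (λ u → (x + u) % n) (m+[n∸m]≡n (m%n≤n k n)) ⟩
      (x + n) % n               ≡⟨ [m+n]%n≡m%n x n ⟩
      x % n                     ∎

  ≈⇒≡ : ∀ {a b} → a < n → b < n → a ≈ b → a ≡ b
  ≈⇒≡ a<n b<n a≈b = trans (sym (m<n⇒m%n≡m a<n)) (trans a≈b (m<n⇒m%n≡m b<n))

  -- For odd n, multiplying by (n/2 + 1) inverts doubling, so doubling cancels.
  *2-cancel : n % 2 ≡ 1 → ∀ {a b} → 2 * a ≈ 2 * b → a ≈ b
  *2-cancel n-odd {a} {b} 2a≈2b =
    trans (sym (halve a)) (trans (*-congˡ (n / 2 + 1) 2a≈2b) (halve b))
    where
    n≡1+2q : n ≡ 1 + n / 2 * 2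
    n≡1+2q = trans (m≡m%n+[m/n]*n n 2) (cong (_+ n / 2 * 2) n-odd)
    halve : ∀ x → (n / 2 + 1) * (2 * x) ≈ x
    halve x = begin
      ((n / 2 + 1) * (2 * x)) % n   ≡⟨ cong (_% n) (solve 2 (λ q x → (q :+ con 1) :* (con 2 :* x) := x :+ x :* (con 1 :+ q :* con 2)) refl (n / 2) x) ⟩
      (x + x * (1 + n / 2 * 2)) % n ≡⟨ cong (λ u → (x + x * u) % n) n≡1+2q ⟨
      (x + x * n) % n               ≡⟨ [m+kn]%n≡m%n x x n ⟩
      x % n                         ∎

  midpoint-end : ∀ {a b c} → c + b ≈ 2 * a → c ≈ a → b ≈ a
  midpoint-end {a} {b} {c} c+b≈2a c≈a = +-cancelˡ a (begin
    (a + b) % n       ≡⟨ +-cong (sym c≈a) refl ⟩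
    (c + b) % n       ≡⟨ c+b≈2a ⟩
    (2 * a) % n       ≡⟨ cong (λ u → (a + u) % n) (+-identityʳ a) ⟩
    (a + a) % n       ∎)

  midpoint-ends : n % 2 ≡ 1 → ∀ {a b c} → c + b ≈ 2 * a → c ≈ b → a ≈ b
  midpoint-ends n-odd {a} {b} {c} c+b≈2a c≈b = *2-cancel n-odd (begin
    (2 * a) % n       ≡⟨ c+b≈2a ⟨
    (c + b) % n       ≡⟨ +-cong c≈b refl ⟩
    (b + b) % n       ≡⟨ cong (λ u → (b + u) % n) (+-identityʳ b) ⟨
    (2 * b) % n       ∎)

  mirror-class : ∀ {w z x Z W A} → w + z ≈ 2 * x → z ≈ Z → x ≈ A → Z + W ≈ 2 * A → w ≈ W
  mirror-class {w} {z} {x} {Z} {W} {A} w+z≈2x z≈Z x≈A Z+W≈2A = +-cancelˡ Z (begin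
    (Z + w) % n       ≡⟨ cong (_% n) (+-comm Z w) ⟩
    (w + Z) % n       ≡⟨ +-cong refl (sym z≈Z) ⟩
    (w + z) % n       ≡⟨ w+z≈2x ⟩
    (2 * x) % n       ≡⟨ *-congˡ 2 x≈A ⟩
    (2 * A) % n       ≡⟨ Z+W≈2A ⟨
    (Z + W) % n       ∎)

≈-divisor : ∀ {s n} .{{_ : NonZero s}} .{{_ : NonZero n}} → s ∣ n →
            ∀ {a b} → a % n ≡ b % n → a % s ≡ b % s
≈-divisor {s} {n} s∣n {a} {b} a≈b =
  trans (sym (m∣n⇒o%n%m≡o%m s n a s∣n)) (trans (cong (_% s) a≈b) (m∣n⇒o%n%m≡o%m s n b s∣n))

module Counting where

  length-filter-split : ∀ {P : ℕ → Set} (P? : Decidable P) xs →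
                        length (filter (∁? P?) xs) + length (filter P? xs) ≡ length xs
  length-filter-split P? [] = refl
  length-filter-split P? (x ∷ xs) with P? x
  ... | yes _ = trans (+-suc _ _) (cong suc (length-filter-split P? xs))
  ... | no _  = cong suc (length-filter-split P? xs)

  -- A duplicate-free list is no longer than any list containing all its elements:
  -- delete the first element from the larger list and recurse.
  unique-⊆-length : ∀ {xs ys : List ℕ} → Unique xs → (∀ {v} → v ∈ xs → v ∈ ys) →
                    length xs ≤ length ys
  unique-⊆-length [] _ = z≤n
  unique-⊆-length {x ∷ xs} (x∉xs ∷ xs-unique) xs⊆ys with ∈-∃++ (xs⊆ys (here refl))
  ... | ys₁ , ys₂ , refl = ≤-trans (s≤s (unique-⊆-length xs-unique xs⊆ys₁++ys₂))
                                   (≤-reflexive (sym (length-++-sucʳ ys₁ x ys₂)))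
    where
    xs⊆ys₁++ys₂ : ∀ {v} → v ∈ xs → v ∈ ys₁ ++ ys₂
    xs⊆ys₁++ys₂ v∈xs with ∈-++⁻ ys₁ (xs⊆ys (there v∈xs))
    ... | inj₁ v∈ys₁         = ∈-++⁺ˡ v∈ys₁
    ... | inj₂ (here v≡x)    = ⊥-elim (lookup x∉xs v∈xs (sym v≡x))
    ... | inj₂ (there v∈ys₂) = ∈-++⁺ʳ ys₁ v∈ys₂

  two-distinct : ∀ {xs : List ℕ} → Unique xs → 2 ≤ length xs →
                 Σ ℕ λ a → Σ ℕ λ b → a ≢ b × a ∈ xs × b ∈ xs
  two-distinct {a ∷ b ∷ _} ((a≢b ∷ _) ∷ _) _ = a , b , a≢b , here refl , there (here refl)
  two-distinct {_ ∷ []} _ (s≤s ())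

  -- If ys is duplicate-free and at least as long as xs, then xs has no more elements
  -- outside ys than ys has outside xs (the common parts are compared via ys's).
  ∖-length-≤ : ∀ xs {ys} → Unique ys → length xs ≤ length ys →
               length (xs ∖ ys) ≤ length (ys ∖ xs)
  ∖-length-≤ xs {ys} ys-unique xs≤ys = +-cancelʳ-≤ (length (filter (_∈? ys) xs)) _ _ (begin
    length (xs ∖ ys) + length (filter (_∈? ys) xs) ≡⟨ length-filter-split (_∈? ys) xs ⟩
    length xs                                      ≤⟨ xs≤ys ⟩
    length ys                                      ≡⟨ length-filter-split (_∈? xs) ys ⟨
    length (ys ∖ xs) + length (filter (_∈? xs) ys) ≤⟨ +-monoʳ-≤ (length (ys ∖ xs)) common ⟩
    length (ys ∖ xs) + length (filter (_∈? ys) xs) ∎)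
    where
    open ≤-Reasoning
    common : length (filter (_∈? xs) ys) ≤ length (filter (_∈? ys) xs)
    common = unique-⊆-length (filter⁺ (_∈? xs) ys-unique) λ v∈ →
      let (v∈ys , v∈xs) = ∈-filter⁻ (_∈? xs) {xs = ys} v∈ in ∈-filter⁺ (_∈? ys) v∈xs v∈ys

module ThreeAPs (n : ℕ) .{{_ : NonZero n}} (c : Coloring n) (no-rainbow : ¬ HasRainbow3AP n c) where

  open Congruence n
  open ≡-Reasoning

  ⟦_⟧ : Fin n → ℕ
  ⟦_⟧ = toℕ

  toℕ-injective-≈ : ∀ {u v : Fin n} → ⟦ u ⟧ ≈ ⟦ v ⟧ → u ≡ v
  toℕ-injective-≈ {u} {v} u≈v = toℕ-injective (≈⇒≡ (toℕ<n u) (toℕ<n v) u≈v)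

  toℕ-mod : ∀ y → ⟦ y mod n ⟧ ≈ y
  toℕ-mod y = trans (cong (_% n) (toℕ-fromℕ< (m%n<n y n))) (mod-≈ y)

  -- Every w + z ≡ 2x is the progression z, z + d, z + 2d with d ≡ x − z.
  as-progression : (z x w : Fin n) → ⟦ w ⟧ + ⟦ z ⟧ ≈ 2 * ⟦ x ⟧ →
                   Σ (Fin n) λ d → ap₁ n z d ≡ x × ap₂ n z d ≡ w
  as-progression z x w w+z≈2x = d , toℕ-injective-≈ z+d≈x , toℕ-injective-≈ z+2d≈w
    where
    -z : ℕ
    -z = n ∸ ⟦ z ⟧
    z+-z≡n : ⟦ z ⟧ + -z ≡ n
    z+-z≡n = m+[n∸m]≡n (<⇒≤ (toℕ<n z))
    d : Fin n
    d = (⟦ x ⟧ + -z) mod n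
    z+d≈x : ⟦ ap₁ n z d ⟧ ≈ ⟦ x ⟧
    z+d≈x = begin
      ⟦ ap₁ n z d ⟧ % n              ≡⟨ toℕ-mod (⟦ z ⟧ + ⟦ d ⟧) ⟩
      (⟦ z ⟧ + ⟦ d ⟧) % n            ≡⟨ +-cong {⟦ z ⟧} refl (toℕ-mod (⟦ x ⟧ + -z)) ⟩
      (⟦ z ⟧ + (⟦ x ⟧ + -z)) % n     ≡⟨ cong (_% n) (solve 3 (λ z x y → z :+ (x :+ y) := x :+ (z :+ y)) refl ⟦ z ⟧ ⟦ x ⟧ -z) ⟩
      (⟦ x ⟧ + (⟦ z ⟧ + -z)) % n     ≡⟨ cong (λ u → (⟦ x ⟧ + u) % n) z+-z≡n ⟩
      (⟦ x ⟧ + n) % n                ≡⟨ [m+n]%n≡m%n ⟦ x ⟧ n ⟩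
      ⟦ x ⟧ % n                      ∎
    z+2d≈w : ⟦ ap₂ n z d ⟧ ≈ ⟦ w ⟧
    z+2d≈w = begin
      ⟦ ap₂ n z d ⟧ % n                     ≡⟨ toℕ-mod (⟦ z ⟧ + 2 * ⟦ d ⟧) ⟩
      (⟦ z ⟧ + 2 * ⟦ d ⟧) % n               ≡⟨ +-cong {⟦ z ⟧} refl (*-congˡ 2 (toℕ-mod (⟦ x ⟧ + -z))) ⟩
      (⟦ z ⟧ + 2 * (⟦ x ⟧ + -z)) % n        ≡⟨ cong (_% n) (solve 3 (λ z x y → z :+ con 2 :* (x :+ y) := (con 2 :* x :+ y) :+ (z :+ y)) refl ⟦ z ⟧ ⟦ x ⟧ -z) ⟩
      (2 * ⟦ x ⟧ + -z + (⟦ z ⟧ + -z)) % n   ≡⟨ cong (λ u → (2 * ⟦ x ⟧ + -z + u) % n) z+-z≡n ⟩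
      (2 * ⟦ x ⟧ + -z + n) % n              ≡⟨ [m+n]%n≡m%n (2 * ⟦ x ⟧ + -z) n ⟩
      (2 * ⟦ x ⟧ + -z) % n                  ≡⟨ +-cong w+z≈2x refl ⟨
      (⟦ w ⟧ + ⟦ z ⟧ + -z) % n              ≡⟨ cong (_% n) (trans (+-assoc ⟦ w ⟧ ⟦ z ⟧ -z) (cong (⟦ w ⟧ +_) z+-z≡n)) ⟩
      (⟦ w ⟧ + n) % n                       ≡⟨ [m+n]%n≡m%n ⟦ w ⟧ n ⟩
      ⟦ w ⟧ % n                             ∎

  ap-collision : (z x w : Fin n) → ⟦ w ⟧ + ⟦ z ⟧ ≈ 2 * ⟦ x ⟧ → z ≢ x → z ≢ w → x ≢ w →
                 c z ≡ c x ⊎ c z ≡ c w ⊎ c x ≡ c w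
  ap-collision z x w w+z≈2x z≢x z≢w x≢w with c z ≟ c x | c z ≟ c w | c x ≟ c w
  ... | yes czx | _       | _       = inj₁ czx
  ... | no _    | yes czw | _       = inj₂ (inj₁ czw)
  ... | no _    | no _    | yes cxw = inj₂ (inj₂ cxw)
  ... | no czx  | no czw  | no cxw  with as-progression z x w w+z≈2x
  ...   | d , refl , refl =
    ⊥-elim (no-rainbow (z , d , d≢0 , z≢x , z≢w , x≢w , czx , czw , cxw))
    where
    d≢0 : toℕ d ≢ 0
    d≢0 d≡0 = z≢x (toℕ-injective-≈ (begin
      ⟦ z ⟧ % n            ≡⟨ cong (_% n) (+-identityʳ ⟦ z ⟧) ⟨
      (⟦ z ⟧ + 0) % n      ≡⟨ cong (λ u → (⟦ z ⟧ + u) % n) d≡0 ⟨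
      (⟦ z ⟧ + ⟦ d ⟧) % n  ≡⟨ toℕ-mod (⟦ z ⟧ + ⟦ d ⟧) ⟨
      ⟦ ap₁ n z d ⟧ % n    ∎))

  reflection-point : (x z : Fin n) → Σ (Fin n) λ w → ⟦ w ⟧ + ⟦ z ⟧ ≈ 2 * ⟦ x ⟧
  reflection-point x z = w , (begin
    (⟦ w ⟧ + ⟦ z ⟧) % n              ≡⟨ +-cong (toℕ-mod (2 * ⟦ x ⟧ + -z)) refl ⟩
    (2 * ⟦ x ⟧ + -z + ⟦ z ⟧) % n     ≡⟨ cong (_% n) (+-assoc (2 * ⟦ x ⟧) -z ⟦ z ⟧) ⟩
    (2 * ⟦ x ⟧ + (-z + ⟦ z ⟧)) % n   ≡⟨ cong (λ u → (2 * ⟦ x ⟧ + u) % n) (m∸n+n≡m (<⇒≤ (toℕ<n z))) ⟩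
    (2 * ⟦ x ⟧ + n) % n              ≡⟨ [m+n]%n≡m%n (2 * ⟦ x ⟧) n ⟩
    (2 * ⟦ x ⟧) % n                  ∎)
    where
    -z : ℕ
    -z = n ∸ ⟦ z ⟧
    w : Fin n
    w = (2 * ⟦ x ⟧ + -z) mod n

module ResidueClasses (s n : ℕ) .{{_ : NonZero s}} .{{_ : NonZero n}} (s∣n : s ∣ n)
                      (c : Coloring n) where

  module Cₛ = Congruence s
  open Cₛ using (_≈_)

  _∈Class_ : Fin n → ℕ → Set
  ℓ ∈Class A = toℕ ℓ ≈ A

  Occurs : ℕ → ℕ → Set
  Occurs A κ = ∃ λ ℓ → ℓ ∈Class A × c ℓ ≡ κ

  SameColours : ℕ → ℕ → Set
  SameColours A B = ∀ κ → Occurs A κ ⇔ Occurs B κ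

  module ⇔ = IsEquivalence (⇔-isEquivalence {ℓ = 0ℓ})

  same-colours-sym : ∀ {A B} → SameColours A B → SameColours B A
  same-colours-sym A~B κ = ⇔.sym (A~B κ)

  same-colours-trans : ∀ {A B C} → SameColours A B → SameColours B C → SameColours A C
  same-colours-trans A~B B~C κ = ⇔.trans (A~B κ) (B~C κ)

  same-colours-≈ : ∀ {A B} → A ≈ B → SameColours A B
  same-colours-≈ A≈B κ = mk⇔ (λ (ℓ , ℓ∈A , cℓ) → ℓ , trans ℓ∈A A≈B , cℓ)
                             (λ (ℓ , ℓ∈B , cℓ) → ℓ , trans ℓ∈B (sym A≈B) , cℓ)

  record TwoMissing (A B : ℕ) : Set where
    constructor two-missing
    field
      colour₁ colour₂ : ℕ
      distinct        : colour₁ ≢ colour₂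
      occurs₁         : Occurs A colour₁
      occurs₂         : Occurs A colour₂
      missing₁        : ¬ Occurs B colour₁
      missing₂        : ¬ Occurs B colour₂

  two-missing-transport : ∀ {A B A′ B′} → TwoMissing A B → SameColours A A′ → SameColours B B′ →
                          TwoMissing A′ B′
  two-missing-transport (two-missing a b a≢b a∈A b∈A a∉B b∉B) A~A′ B~B′ =
    two-missing a b a≢b (Equivalence.to (A~A′ a) a∈A) (Equivalence.to (A~A′ b) b∈A)
      (λ a∈B′ → a∉B (Equivalence.from (B~B′ a) a∈B′)) (λ b∈B′ → b∉B (Equivalence.from (B~B′ b) b∈B′))

  class-apart : ∀ {A B ℓ ℓ′} → ℓ ∈Class A → ℓ′ ∈Class B → ¬ A ≈ B → ℓ ≢ ℓ′
  class-apart ℓ∈A ℓ′∈B A≉B refl = A≉B (trans (sym ℓ∈A) ℓ′∈B)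

  module WithoutRainbow (s-odd : s % 2 ≡ 1) (no-rainbow : ¬ HasRainbow3AP n c) where

    open ThreeAPs n c no-rainbow
    open Congruence n using () renaming (_≈_ to _≈ₙ_)

    mirror : ∀ {Z W A} (x z : Fin n) → x ∈Class A → z ∈Class Z → Z + W ≈ 2 * A →
             Σ (Fin n) λ w → w ∈Class W × toℕ w + toℕ z ≈ₙ 2 * toℕ x
    mirror x z x∈A z∈Z Z+W≈2A with reflection-point x z
    ... | w , w+z≈2x = w , Cₛ.mirror-class (≈-divisor s∣n w+z≈2x) z∈Z x∈A Z+W≈2A , w+z≈2x

    reflection : ∀ {A B C} → C + B ≈ 2 * A → TwoMissing A B → SameColours C B
    reflection {A} {B} {C} C+B≈2A (two-missing a b a≢b (x , x∈A , cx≡a) (x′ , x′∈A , cx′≡b) a∉B b∉B) κ =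
      mk⇔ to from
      where
      A≉B : ¬ A ≈ B
      A≉B A≈B = a∉B (x , trans x∈A A≈B , cx≡a)
      C≉A : ¬ C ≈ A
      C≉A C≈A = A≉B (sym (Cₛ.midpoint-end C+B≈2A C≈A))
      C≉B : ¬ C ≈ B
      C≉B C≈B = A≉B (Cₛ.midpoint-ends s-odd C+B≈2A C≈B)
      B+C≈2A : B + C ≈ 2 * A
      B+C≈2A = trans (cong (_% s) (+-comm B C)) C+B≈2A
      -- No point of C has colour a: reflect it in x′, of colour b.
      a-absent : ∀ z → z ∈Class C → c z ≢ a
      a-absent z z∈C cz≡a with mirror {C} {B} x′ z x′∈A z∈C C+B≈2A
      ... | v , v∈B , v+z≈2x′
        with ap-collision z x′ v v+z≈2x′ (class-apart z∈C x′∈A C≉A) (class-apart z∈C v∈B C≉B)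
                                         (class-apart x′∈A v∈B A≉B)
      ...   | inj₁ cz≡cx′        = a≢b (trans (sym cz≡a) (trans cz≡cx′ cx′≡b))
      ...   | inj₂ (inj₁ cz≡cv)  = a∉B (v , v∈B , trans (sym cz≡cv) cz≡a)
      ...   | inj₂ (inj₂ cx′≡cv) = b∉B (v , v∈B , trans (sym cx′≡cv) cx′≡b)
      -- Hence z ∈ C and its reflection v ∈ B in x, of colour a, share a colour.
      mirrored-colour : ∀ z v → z ∈Class C → v ∈Class B → toℕ v + toℕ z ≈ₙ 2 * toℕ x → c z ≡ c v
      mirrored-colour z v z∈C v∈B v+z≈2x
        with ap-collision z x v v+z≈2x (class-apart z∈C x∈A C≉A) (class-apart z∈C v∈B C≉B)
                                       (class-apart x∈A v∈B A≉B)
      ... | inj₁ cz≡cx        = ⊥-elim (a-absent z z∈C (trans cz≡cx cx≡a))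
      ... | inj₂ (inj₁ cz≡cv) = cz≡cv
      ... | inj₂ (inj₂ cx≡cv) = ⊥-elim (a∉B (v , v∈B , trans (sym cx≡cv) cx≡a))
      to : Occurs C κ → Occurs B κ
      to (z , z∈C , cz≡κ) with mirror {C} {B} x z x∈A z∈C C+B≈2A
      ... | v , v∈B , v+z≈2x = v , v∈B , trans (sym (mirrored-colour z v z∈C v∈B v+z≈2x)) cz≡κ
      from : Occurs B κ → Occurs C κ
      from (v , v∈B , cv≡κ) with mirror {B} {C} x v x∈A v∈B B+C≈2A
      ... | z , z∈C , z+v≈2x =
        z , z∈C , trans (mirrored-colour z v z∈C v∈B (trans (cong (_% n) (+-comm (toℕ v) (toℕ z))) z+v≈2x)) cv≡κ

    -- Along the progression term r = I + r·(M − I) (mod s) the reflection lemma makes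
    -- the classes alternate between the colours of I and of M; term s ≡ I sits at the
    -- odd position s, so I would carry the colours of M.
    no-mutual-two-missing : ∀ {I M} → I ≤ s → TwoMissing I M → TwoMissing M I → ⊥
    no-mutual-two-missing {I} {M} I≤s I∖M M∖I =
      TwoMissing.missing₁ I∖M (Equivalence.to (I~M (TwoMissing.colour₁ I∖M)) (TwoMissing.occurs₁ I∖M))
      where
      δ : ℕ
      δ = M + (s ∸ I)
      term : ℕ → ℕ
      term r = I + r * δ

      term-AP : ∀ k → term (2 + k) + term k ≈ 2 * term (1 + k)
      term-AP k = cong (_% s) (solve 3 (λ I k d → (I :+ (con 2 :+ k) :* d) :+ (I :+ k :* d)
                                                  := con 2 :* (I :+ (con 1 :+ k) :* d)) refl I k δ)

      term-1≈M : term 1 ≈ M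
      term-1≈M = trans (cong (_% s) term-1≡M+s) ([m+n]%n≡m%n M s)
        where
        term-1≡M+s : term 1 ≡ M + s
        term-1≡M+s = trans (solve 3 (λ I M e → I :+ ((M :+ e) :+ con 0) := M :+ (I :+ e)) refl I M (s ∸ I))
                           (cong (M +_) (m+[n∸m]≡n I≤s))

      term-s≈I : term s ≈ I
      term-s≈I = trans (cong (λ u → (I + u) % s) (*-comm s δ)) ([m+kn]%n≡m%n I δ s)

      propagate : ∀ k {X Y} → SameColours (term k) X → SameColours (term (1 + k)) Y → TwoMissing Y X →
                  SameColours (term (2 + k)) X
      propagate k k~X k+1~Y Y∖X = same-colours-trans (reflection (term-AP k)
        (two-missing-transport Y∖X (same-colours-sym k+1~Y) (same-colours-sym k~X))) k~X

      alternate : ∀ r → SameColours (term (r * 2)) I × SameColours (term (1 + r * 2)) M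
      alternate zero    = same-colours-≈ (cong (_% s) (+-identityʳ I)) , same-colours-≈ term-1≈M
      alternate (suc r) with alternate r
      ... | even~I , odd~M = next-even~I , propagate (1 + r * 2) odd~M next-even~I I∖M
        where
        next-even~I : SameColours (term (suc r * 2)) I
        next-even~I = propagate (r * 2) even~I odd~M M∖I

      s≡1+2q : s ≡ 1 + s / 2 * 2
      s≡1+2q = trans (m≡m%n+[m/n]*n s 2) (cong (_+ s / 2 * 2) s-odd)

      I~M : SameColours I M
      I~M = same-colours-trans (same-colours-≈ (sym term-s≈I))
              (subst (λ k → SameColours (term k) M) (sym s≡1+2q) (proj₂ (alternate (s / 2))))

-- The lists P_j of the statement are the colour sets of the residue classes of ℤ_{st}.
module ColourLists (s t : ℕ) .{{_ : NonZero s}} .{{_ : NonZero t}} (c : Coloring (s * t)) where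

  instance
    st≢0 : NonZero (s * t)
    st≢0 = m*n≢0 s t

  open ResidueClasses s (s * t) (m∣m*n t) c
  open Counting using (two-distinct)

  toℕ%s : ∀ (j : Fin s) → toℕ j % s ≡ toℕ j
  toℕ%s j = m<n⇒m%n≡m (toℕ<n j)

  ∈P⇒Occurs : ∀ j {κ} → κ ∈ P s t c j → Occurs (toℕ j) κ
  ∈P⇒Occurs j κ∈Pj with ∈-map∘filter⁻ c (λ ℓ → toℕ ℓ % s ≟ toℕ j) {xs = allFin (s * t)}
                          (∈-deduplicate⁻ _≟_ _ κ∈Pj)
  ... | ℓ , _ , κ≡cℓ , ℓ∈Rj = ℓ , trans ℓ∈Rj (sym (toℕ%s j)) , sym κ≡cℓ

  Occurs⇒∈P : ∀ j {κ} → Occurs (toℕ j) κ → κ ∈ P s t c j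
  Occurs⇒∈P j (ℓ , ℓ∈j , cℓ≡κ) =
    ∈-deduplicate⁺ _≟_ (∈-map∘filter⁺ c _ (ℓ , ∈-allFin ℓ , sym cℓ≡κ , trans ℓ∈j (toℕ%s j)))

  unique-P : ∀ j → Unique (P s t c j)
  unique-P j = deduplicate-! _

  two-missing-of : ∀ j k → 2 ≤ length (P s t c j ∖ P s t c k) → TwoMissing (toℕ j) (toℕ k)
  two-missing-of j k two≤ with two-distinct (filter⁺ _ (unique-P j)) two≤
  ... | a , b , a≢b , a∈ , b∈ with ∈-filter⁻ _ a∈ | ∈-filter⁻ _ b∈
  ...   | a∈Pj , a∉Pk | b∈Pj , b∉Pk =
    two-missing a b a≢b (∈P⇒Occurs j a∈Pj) (∈P⇒Occurs j b∈Pj)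
      (λ a∈k → a∉Pk (Occurs⇒∈P k a∈k)) (λ b∈k → b∉Pk (Occurs⇒∈P k b∈k))

-- Proposition 3.9.  If |P_i ∖ P_m| ≥ 2 then, as |P_i| ≤ |P_m|, also |P_m ∖ P_i| ≥ 2,
-- and the classes i, m would each miss two colours of the other.
proposition3p9 : (s t : ℕ) .{{_ : NonZero s}} .{{_ : NonZero t}} → s % 2 ≡ 1
    → (c : Coloring (s * t)) → ¬ HasRainbow3AP (s * t) {{m*n≢0 s t}} c
    → (m : Fin s) → (∀ i → length (P s t c i) ≤ length (P s t c m))
    → ∀ i → length (P s t c i ∖ P s t c m) ≤ 1
proposition3p9 s t s-odd c no-rainbow m maximal i with length (P s t c i ∖ P s t c m) ≤? 1
... | yes at-most-one = at-most-one
... | no more =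
  ⊥-elim (no-mutual-two-missing (<⇒≤ (toℕ<n i)) (two-missing-of i m i∖m≥2) (two-missing-of m i m∖i≥2))
  where
  open ColourLists s t c
  open ResidueClasses.WithoutRainbow s (s * t) (m∣m*n t) c s-odd no-rainbow
  i∖m≥2 : 2 ≤ length (P s t c i ∖ P s t c m)
  i∖m≥2 = ≰⇒> more
  m∖i≥2 : 2 ≤ length (P s t c m ∖ P s t c i)
  m∖i≥2 = ≤-trans i∖m≥2 (Counting.∖-length-≤ (P s t c i) (unique-P m) (maximal i))
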